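{- For every partial epistemic frame $\mathcal M$ and every $\mathsf{KB4}$-formula $\Phi$: $\Phi$ is valid in $\mathcal M$ if and only if $t(\Phi)$ is valid in $\eta(\mathcal M)$.
   Context: Fix a finite set $\mathcal A$ of agents and a set $AP$ of atomic propositions. A partial epistemic frame $\mathcal M$ is a set $M$ with partial equivalence relations (symmetric, transitive) $\sim_a$ ($a\in\mathcal A$) such that each $w\in M$ has $w\sim_a w$ for some $a$. $\mathsf{KB4}$-formulas: $\Phi::=p\mid\neg\Phi\mid\Phi\wedge\Psi\mid K_a\Phi$ ($p\in AP$); given a valuation $L:AP\to\mathcal P(M)$, $w\models p$ iff $w\in L(p)$, classical $\neg,\wedge$, $w\models K_a\Phi$ iff $w'\models\Phi$ for all $w'$ with $w\sim_a w'$. $\Phi$ is valid in $\mathcal M$ if it holds at every world under every valuation. $\mathsf{2CH}$ over $AP_e=AP$, $AP_a=\varnothing$: agent formulas of sort $a$: $\varphi::=\neg\varphi\mid\varphi\wedge\psi\mid\Diamond_a\Phi$; world formulas: $\Phi::=p\mid\neg\Phi\mid\Phi\wedge\Psi\mid\langle a\rangle\varphi$; $\Box_a\Phi:=\neg\Diamond_a\neg\Phi$, $[a]\varphi:=\neg\langle a\rangle\neg\varphi$. A chromatic hypergraph: set $E$, sets $V_a$, surjective partial functions $\pi_a:E\rightharpoonup V_a$ with each $e$ having some $\pi_a(e)$ defined; with valuation $\ell_e:AP\to\mathcal P(E)$: $e\models_e p$ iff $e\in\ell_e(p)$; classical $\neg,\wedge$; $v\models_a\Diamond_a\Phi$ iff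 $e\models_e\Phi$ for some $e$ with $\pi_a(e)=v$; $e\models_e\langle a\rangle\varphi$ iff $\pi_a(e)$ defined and $\pi_a(e)\models_a\varphi$. A world formula is valid in a chromatic hypergraph if it holds at every hyperedge under every valuation. $\eta(\mathcal M)$: hyperedges $E=M$, $V_a$ = the set of $\sim_a$-equivalence classes, $\pi_a(w)=[w]_a$ if $w\sim_a w$ (undefined otherwise). Translation $t$: $t(p)=p$, $t(\neg\Phi)=\neg t(\Phi)$, $t(\Phi\wedge\Psi)=t(\Phi)\wedge t(\Psi)$, $t(K_a\Phi)=[a]\Box_a t(\Phi)$. -}

module Defs where

open import Data.Nat using (ℕ)
open import Data.Fin using (Fin)
open import Data.Product using (Σ; ∃; _×_; _,_)
open import Data.Empty using (⊥)
open import Relation.Nullary using (¬_)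
open import Relation.Binary.Structures using (IsPartialEquivalence; IsEquivalence)
open import Relation.Binary.PropositionalEquality using (_≡_)

module _ (n : ℕ) (AP : Set) where

  Agent : Set
  Agent = Fin n

  record PartialEpistemicFrame : Set₁ where
    field
      M       : Set
      _∼⟨_⟩_  : M → Agent → M → Set
      isPER   : ∀ a → IsPartialEquivalence (λ w w' → w ∼⟨ a ⟩ w')
      covered : ∀ w → ∃ λ a → w ∼⟨ a ⟩ w

  data KB4 : Set where
    atom : AP → KB4
    ¬ᴷ_  : KB4 → KB4
    _∧ᴷ_ : KB4 → KB4 → KB4
    K    : Agent → KB4 → KB4

  module _ (𝓜 : PartialEpistemicFrame) where
    open PartialEpistemicFrame 𝓜

    _,_⊨ᴷ_ : (AP → M → Set) → M → KB4 → Set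
    L , w ⊨ᴷ atom p   = L p w
    L , w ⊨ᴷ (¬ᴷ Φ)   = ¬ (L , w ⊨ᴷ Φ)
    L , w ⊨ᴷ (Φ ∧ᴷ Ψ) = (L , w ⊨ᴷ Φ) × (L , w ⊨ᴷ Ψ)
    L , w ⊨ᴷ K a Φ    = ∀ w' → w ∼⟨ a ⟩ w' → L , w' ⊨ᴷ Φ

    ValidInFrame : KB4 → Set₁
    ValidInFrame Φ = ∀ (L : AP → M → Set) (w : M) → L , w ⊨ᴷ Φ

  -- 2CH formulas with AP_e = AP, AP_a = ∅
  data WF : Set
  data AF : Agent → Set

  data WF where
    atom : AP → WF
    ¬ʷ_  : WF → WF
    _∧ʷ_ : WF → WF → WF
    ⟨_⟩_ : (a : Agent) → AF a → WF

  data AF where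
    ¬ᵃ_  : ∀ {a} → AF a → AF a
    _∧ᵃ_ : ∀ {a} → AF a → AF a → AF a
    ◇    : (a : Agent) → WF → AF a

  □ : (a : Agent) → WF → AF a
  □ a Φ = ¬ᵃ (◇ a (¬ʷ Φ))

  [_]_ : (a : Agent) → AF a → WF
  [ a ] φ = ¬ʷ (⟨ a ⟩ (¬ᵃ φ))

  -- Since Agda has no quotient types, each
  -- vertex set V a is a setoid (carrier with an equivalence _≈_), and
  -- "π_a(e) = v" is read up to this equivalence.  A partial function
  -- π_a : E ⇀ V_a is given by its domain predicate dom a and a map
  -- defined on the domain.
  record ChromaticHypergraph : Set₁ where
    field
      E       : Set
      V       : Agent → Set
      _≈⟨_⟩_  : ∀ {a} → V a → Agent → V a → Set
      ≈-equiv : ∀ a → IsEquivalence (λ (v v' : V a) → v ≈⟨ a ⟩ v')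
      dom     : Agent → E → Set
      π       : ∀ a (e : E) → dom a e → V a
      π-surj  : ∀ a (v : V a) → Σ E λ e → Σ (dom a e) λ d → π a e d ≈⟨ a ⟩ v
      covered : ∀ e → ∃ λ a → dom a e

  module _ (H : ChromaticHypergraph) where
    open ChromaticHypergraph H

    _,_⊨ₑ_ : (AP → E → Set) → E → WF → Set
    _,_,_⊨ₐ_ : (AP → E → Set) → (a : Agent) → V a → AF a → Set

    ℓ , e ⊨ₑ atom p    = ℓ p e
    ℓ , e ⊨ₑ (¬ʷ Φ)    = ¬ (ℓ , e ⊨ₑ Φ)
    ℓ , e ⊨ₑ (Φ ∧ʷ Ψ)  = (ℓ , e ⊨ₑ Φ) × (ℓ , e ⊨ₑ Ψ)
    ℓ , e ⊨ₑ (⟨ a ⟩ φ) = Σ (dom a e) λ d → ℓ , a , π a e d ⊨ₐ φ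

    ℓ , a , v ⊨ₐ (¬ᵃ φ)   = ¬ (ℓ , a , v ⊨ₐ φ)
    ℓ , a , v ⊨ₐ (φ ∧ᵃ ψ) = (ℓ , a , v ⊨ₐ φ) × (ℓ , a , v ⊨ₐ ψ)
    ℓ , a , v ⊨ₐ ◇ .a Φ   =
      Σ E λ e → Σ (dom a e) λ d → (π a e d ≈⟨ a ⟩ v) × (ℓ , e ⊨ₑ Φ)

    ValidInHypergraph : WF → Set₁
    ValidInHypergraph Φ = ∀ (ℓ : AP → E → Set) (e : E) → ℓ , e ⊨ₑ Φ

  -- η(𝓜): hyperedges = worlds; V a = worlds in the domain of ∼_a,
  -- identified up to ∼_a (i.e. the ∼_a-equivalence classes);
  -- π_a(w) = [w]_a, defined iff w ∼_a w.
  η : PartialEpistemicFrame → ChromaticHypergraph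
  η 𝓜 = record
    { E       = M
    ; V       = λ a → Σ M λ w → w ∼⟨ a ⟩ w
    ; _≈⟨_⟩_  = λ { (w , _) a (w' , _) → w ∼⟨ a ⟩ w' }
    ; ≈-equiv = λ a → record
        { refl  = λ { {w , r} → r }
        ; sym   = IsPartialEquivalence.sym (isPER a)
        ; trans = IsPartialEquivalence.trans (isPER a) }
    ; dom     = λ a w → w ∼⟨ a ⟩ w
    ; π       = λ a w d → (w , d)
    ; π-surj  = λ { a (w , r) → w , r , r }
    ; covered = covered
    }
    where open PartialEpistemicFrame 𝓜

  t : KB4 → WF
  t (atom p)   = atom p
  t (¬ᴷ Φ)     = ¬ʷ (t Φ)
  t (Φ ∧ᴷ Ψ)   = t Φ ∧ʷ t Ψ
  t (K a Φ)    = [ a ] (□ a (t Φ))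

-- The only real case is K a Φ: in η(𝓜), [a]□ₐ Ψ
-- holds at w iff, when w lies in the domain of ∼ₐ, every hyperedge whose
-- a-vertex is [w]ₐ satisfies Ψ, i.e. iff Ψ holds at all ∼ₐ-successors of w
-- (vacuously outside the domain, exactly as for K a). The translation reaches
-- that universal statement only through negations, hence the need for
-- double negation elimination.
module Submission where

open import Defs
open import Data.Nat using (ℕ)
open import Data.Product using (_×_; _,_)
open import Axiom.ExcludedMiddle using (ExcludedMiddle)
open import Axiom.DoubleNegationElimination using (DoubleNegationElimination; em⇒dne)
import Level
open import Relation.Binary.Bundles using (PartialSetoid)
import Relation.Binary.Properties.PartialSetoid as PartialSetoidProperties

module _ (n : ℕ) (AP : Set) (𝓜 : PartialEpistemicFrame n AP) where
  open PartialEpistemicFrame 𝓜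

  _,_⊨_ : (AP → M → Set) → M → KB4 n AP → Set
  _,_⊨_ = _,_⊨ᴷ_ n AP 𝓜

  _,_⊨η_ : (AP → M → Set) → M → WF n AP → Set
  _,_⊨η_ = _,_⊨ₑ_ n AP (η n AP 𝓜)

  indistinguishability : Agent n AP → PartialSetoid Level.zero Level.zero
  indistinguishability a = record { isPartialEquivalence = isPER a }

  module ∼ (a : Agent n AP) where
    open PartialSetoid (indistinguishability a) public using (sym)
    open PartialSetoidProperties (indistinguishability a) public
      using (partial-reflˡ; partial-reflʳ)

  [_]□_ : Agent n AP → WF n AP → WF n AP
  [ a ]□ Ψ = [_]_ n AP a (□ n AP a Ψ)

  module _ (L : AP → M → Set) (a : Agent n AP) (Ψ : WF n AP) (w : M) where

    []□-intro : (∀ w' → w ∼⟨ a ⟩ w' → L , w' ⊨η Ψ) → L , w ⊨η ([ a ]□ Ψ)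
    []□-intro everywhere (_ , ¬¬counterexample) =
      ¬¬counterexample λ { (w' , _ , w'∼w , ¬Ψ) → ¬Ψ (everywhere w' (∼.sym a w'∼w)) }

    []□-elim : DoubleNegationElimination Level.zero →
               L , w ⊨η ([ a ]□ Ψ) → ∀ w' → w ∼⟨ a ⟩ w' → L , w' ⊨η Ψ
    []□-elim dne h w' w∼w' = dne λ ¬Ψ →
      h (∼.partial-reflˡ a w∼w' , λ ¬counterexample →
           ¬counterexample (w' , ∼.partial-reflʳ a w∼w' , ∼.sym a w∼w' , ¬Ψ))

  module _ (dne : DoubleNegationElimination Level.zero) (L : AP → M → Set) where

    ⊨⇒⊨t : ∀ Φ w → L , w ⊨ Φ → L , w ⊨η t n AP Φ
    ⊨t⇒⊨ : ∀ Φ w → L , w ⊨η t n AP Φ → L , w ⊨ Φ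

    ⊨⇒⊨t (atom p)  w h         = h
    ⊨⇒⊨t (¬ᴷ Φ)    w h ht      = h (⊨t⇒⊨ Φ w ht)
    ⊨⇒⊨t (Φ ∧ᴷ Ψ)  w (hΦ , hΨ) = ⊨⇒⊨t Φ w hΦ , ⊨⇒⊨t Ψ w hΨ
    ⊨⇒⊨t (K a Φ)   w h         =
      []□-intro L a (t n AP Φ) w λ w' w∼w' → ⊨⇒⊨t Φ w' (h w' w∼w')

    ⊨t⇒⊨ (atom p)  w h         = h
    ⊨t⇒⊨ (¬ᴷ Φ)    w h hΦ      = h (⊨⇒⊨t Φ w hΦ)
    ⊨t⇒⊨ (Φ ∧ᴷ Ψ)  w (hΦ , hΨ) = ⊨t⇒⊨ Φ w hΦ , ⊨t⇒⊨ Ψ w hΨ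
    ⊨t⇒⊨ (K a Φ)   w h w' w∼w' =
      ⊨t⇒⊨ Φ w' ([]□-elim L a (t n AP Φ) w dne h w' w∼w')

mainTheorem12 : ExcludedMiddle Level.zero →
    (n : ℕ) (AP : Set) (𝓜 : PartialEpistemicFrame n AP) (Φ : KB4 n AP) →
    (ValidInFrame n AP 𝓜 Φ → ValidInHypergraph n AP (η n AP 𝓜) (t n AP Φ))
    × (ValidInHypergraph n AP (η n AP 𝓜) (t n AP Φ) → ValidInFrame n AP 𝓜 Φ)
mainTheorem12 em n AP 𝓜 Φ =
  (λ valid L w → ⊨⇒⊨t n AP 𝓜 dne L Φ w (valid L w)) ,
  (λ valid L w → ⊨t⇒⊨ n AP 𝓜 dne L Φ w (valid L w))
  where
  dne : DoubleNegationElimination Level.zero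
  dne = em⇒dne em
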